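{- If $G$ is an outerplanar graph with $\Delta(G)\le8$, then $\mu_{\mathrm{int}}(G)\le2$.
   Context: Graphs are finite and simple; $\Delta(G)$ is the maximum degree. A graph is outerplanar if it has a planar embedding with all vertices on the outer face. A $k$-improper edge coloring of $G$ is a map $\alpha:E(G)\to\mathbb{N}$ such that at most $k$ edges with a common endpoint receive the same color; it is an improper interval coloring if at every vertex the colors on incident edges form a set of consecutive integers. $\mu_{\mathrm{int}}(G)$ is the smallest $k$ such that $G$ has a $k$-improper interval edge coloring. -}

module Defs where

open import Data.Nat using (ℕ; zero; suc; _+_; _≤_; _<_; _≡ᵇ_)
open import Data.Fin using (Fin; toℕ)
import Data.Fin as Fin
open import Data.Bool using (Bool; true; false; _∧_; if_then_else_)
open import Data.Product using (Σ; ∃; _×_; _,_)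
open import Relation.Binary.PropositionalEquality using (_≡_)
open import Relation.Nullary using (¬_)
open import Function.Definitions using (Injective)

record Graph (n : ℕ) : Set where
  field
    adj     : Fin n → Fin n → Bool
    symm    : ∀ u v → adj u v ≡ adj v u
    irrefl  : ∀ v → adj v v ≡ false
open Graph public

count : ∀ {n} → (Fin n → Bool) → ℕ
count {zero}  P = 0
count {suc n} P = (if P Fin.zero then 1 else 0) + count (λ i → P (Fin.suc i))

degree : ∀ {n} → Graph n → Fin n → ℕ
degree G v = count (adj G v)

MaxDegree≤ : ∀ {n} → Graph n → ℕ → Set
MaxDegree≤ G d = ∀ v → degree G v ≤ d

-- Outerplanar: the vertices can be placed in a cyclic order (on a circle,
-- the boundary of the outer face) by an injective position map pos such that
-- no two edges cross, i.e. there are no edges uv, xy with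
-- pos u < pos x < pos v < pos y  (combinatorial outerplane embedding).
Outerplanar : ∀ {n} → Graph n → Set
Outerplanar {n} G =
  Σ (Fin n → Fin n) λ pos →
    Injective _≡_ _≡_ pos ×
    (∀ u v x y → adj G u v ≡ true → adj G x y ≡ true →
       ¬ (toℕ (pos u) < toℕ (pos x) × toℕ (pos x) < toℕ (pos v)
          × toℕ (pos v) < toℕ (pos y)))

-- An edge coloring: α u v is the color of edge uv (values on non-edges are
-- irrelevant); it must be well defined on edges (symmetric).
EdgeColoring : ∀ {n} → Graph n → (Fin n → Fin n → ℕ) → Set
EdgeColoring G α = ∀ u v → adj G u v ≡ true → α u v ≡ α v u

Improper : ∀ {n} → Graph n → ℕ → (Fin n → Fin n → ℕ) → Set
Improper G k α = ∀ v c → count (λ w → adj G v w ∧ (α v w ≡ᵇ c)) ≤ k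

Interval : ∀ {n} → Graph n → (Fin n → Fin n → ℕ) → Set
Interval G α = ∀ v w₁ w₂ c → adj G v w₁ ≡ true → adj G v w₂ ≡ true →
  α v w₁ ≤ c → c ≤ α v w₂ → ∃ λ w → adj G v w ≡ true × α v w ≡ c

HasImproperIntervalColoring : ∀ {n} → Graph n → ℕ → Set
HasImproperIntervalColoring G k =
  ∃ λ α → EdgeColoring G α × Improper G k α × Interval G α

-- μ_int(G) ≤ m  (μ_int is the least such k, so this means some k ≤ m works)
μint≤ : ∀ {n} → Graph n → ℕ → Set
μint≤ G m = ∃ λ k → k ≤ m × HasImproperIntervalColoring G k

module Submission where

-- Place the vertices on the circle in the order of the embedding and let the depth of v be the
-- number of edges passing over v. Colour an edge uv with u before v by depth u plus the number of
-- neighbours of u beyond v. Counting the edges xy ≠ uv with x ≤ u < v ≤ y once row by row and once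
-- column by column, non-crossing shows that this equals depth v plus the number of neighbours of v
-- before u. So at every vertex v the forward edges get the colours depth v, depth v + 1, ...
-- bijectively, and so do the backward edges: every colour occurs at most twice and the colours form
-- an interval.

open import Defs
open import Data.Nat using (ℕ; zero; suc; _+_; _∸_; _≤_; _<_; _<ᵇ_; _≤?_; _<?_; z≤n; s≤s; s≤s⁻¹; s<s⁻¹)
open import Data.Nat.Properties hiding (_≟_; _≤?_; _<?_)
import Data.Nat.Properties as ℕ
open import Data.Fin using (Fin; zero; suc; toℕ; _≟_)
import Data.Fin.Properties as Fin
open import Data.Bool using (true; false; T; T?; if_then_else_)
open import Data.Bool.Properties using (T-≡)
open import Data.Product using (∃; _×_; _,_; proj₁; proj₂)
open import Data.Sum using (_⊎_; inj₁; inj₂)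
open import Function using (_∘_; Equivalence)
open import Function.Definitions using (Injective)
open import Level using (Level; _⊔_)
open import Algebra.Properties.CommutativeMonoid.Sum +-0-commutativeMonoid
  using (sum-syntax; sum-cong-≗; sum-replicate-zero; ∑-distrib-+; ∑-comm)
open import Relation.Binary using (StrictTotalOrder; tri<; tri≈; tri>)
import Relation.Binary.Construct.Flip.EqAndOrd as Flip
open import Relation.Binary.PropositionalEquality
open import Relation.Nullary using (¬_; Dec; yes; no; does; contradiction; _×-dec_; _⊎-dec_)
open import Relation.Nullary.Reflects using (ofʸ; ofⁿ)
open import Relation.Unary using (Pred; Decidable; Empty; _⊆_; _≐_; _∪_; _⊥_)
open import Relation.Unary.Properties using (_∪?_; _∩?_)

private variable
  ℓ ℓ′ ℓ″ : Level
  m n : ℕ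

-- Counting decidable subsets of Fin n

size : {A : Pred (Fin n) ℓ} → Decidable A → ℕ
size A? = count (λ x → does (A? x))

size-⊆ : {A : Pred (Fin n) ℓ} {B : Pred (Fin n) ℓ′} (A? : Decidable A) (B? : Decidable B) →
         A ⊆ B → size A? ≤ size B?
size-⊆ {zero} A? B? A⊆B = z≤n
size-⊆ {suc n} A? B? A⊆B with A? zero | B? zero
... | yes a | yes _ = s≤s (size-⊆ (A? ∘ suc) (B? ∘ suc) A⊆B)
... | yes a | no ¬b = contradiction (A⊆B a) ¬b
... | no _  | yes _ = m≤n⇒m≤1+n (size-⊆ (A? ∘ suc) (B? ∘ suc) A⊆B)
... | no _  | no _  = size-⊆ (A? ∘ suc) (B? ∘ suc) A⊆B

size-∪-∩ : {A : Pred (Fin n) ℓ} {B : Pred (Fin n) ℓ′} (A? : Decidable A) (B? : Decidable B) →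
           size (A? ∪? B?) + size (A? ∩? B?) ≡ size A? + size B?
size-∪-∩ {zero} A? B? = refl
size-∪-∩ {suc n} A? B? with A? zero | B? zero | size-∪-∩ (A? ∘ suc) (B? ∘ suc)
... | yes _ | yes _ | ih = cong suc (trans (+-suc _ _) (trans (cong suc ih) (sym (+-suc _ _))))
... | yes _ | no _  | ih = cong suc ih
... | no _  | yes _ | ih = trans (cong suc ih) (sym (+-suc _ _))
... | no _  | no _  | ih = ih

size-⊂ : {A : Pred (Fin n) ℓ} {B : Pred (Fin n) ℓ′} (A? : Decidable A) (B? : Decidable B) →
         A ⊆ B → ∀ z → B z → ¬ A z → size A? < size B?
size-⊂ {suc n} A? B? A⊆B zero bz ¬az with A? zero | B? zero
... | yes az | _     = contradiction az ¬az
... | no _   | yes _ = s≤s (size-⊆ (A? ∘ suc) (B? ∘ suc) A⊆B)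
... | no _   | no ¬b = contradiction bz ¬b
size-⊂ {suc n} A? B? A⊆B (suc z) bz ¬az with A? zero | B? zero
... | yes _ | yes _ = s≤s (size-⊂ (A? ∘ suc) (B? ∘ suc) A⊆B z bz ¬az)
... | yes a | no ¬b = contradiction (A⊆B a) ¬b
... | no _  | yes _ = m<n⇒m<1+n (size-⊂ (A? ∘ suc) (B? ∘ suc) A⊆B z bz ¬az)
... | no _  | no _  = size-⊂ (A? ∘ suc) (B? ∘ suc) A⊆B z bz ¬az

size-≐ : {A : Pred (Fin n) ℓ} {B : Pred (Fin n) ℓ′} (A? : Decidable A) (B? : Decidable B) →
         A ≐ B → size A? ≡ size B?
size-≐ A? B? (A⊆B , B⊆A) = ≤-antisym (size-⊆ A? B? A⊆B) (size-⊆ B? A? B⊆A)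

size-∅ : {A : Pred (Fin n) ℓ} (A? : Decidable A) → Empty A → size A? ≡ 0
size-∅ {zero} A? _ = refl
size-∅ {suc n} A? ∅A with A? zero
... | yes a = contradiction a (∅A zero)
... | no _  = size-∅ (A? ∘ suc) (λ x → ∅A (suc x))

size-≤1 : {A : Pred (Fin n) ℓ} (A? : Decidable A) → (∀ {x y} → A x → A y → x ≡ y) → size A? ≤ 1
size-≤1 {zero} A? _ = z≤n
size-≤1 {suc n} A? unique with A? zero
... | yes a = ≤-reflexive (cong suc (size-∅ (A? ∘ suc) (λ x a′ → Fin.0≢1+n (unique a a′))))
... | no _  = size-≤1 (A? ∘ suc) (λ a a′ → Fin.suc-injective (unique a a′))

size-⊆-∪ : {A : Pred (Fin n) ℓ} {B : Pred (Fin n) ℓ′} {C : Pred (Fin n) ℓ″}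
           (A? : Decidable A) (B? : Decidable B) (C? : Decidable C) →
           C ⊆ A ∪ B → size C? ≤ size A? + size B?
size-⊆-∪ A? B? C? C⊆A∪B = begin
  size C?                              ≤⟨ size-⊆ C? (A? ∪? B?) C⊆A∪B ⟩
  size (A? ∪? B?)                      ≤⟨ m≤m+n _ _ ⟩
  size (A? ∪? B?) + size (A? ∩? B?)    ≡⟨ size-∪-∩ A? B? ⟩
  size A? + size B?                    ∎
  where open ≤-Reasoning

size-partition : {A : Pred (Fin n) ℓ} {B : Pred (Fin n) ℓ′} {C : Pred (Fin n) ℓ″}
                 (A? : Decidable A) (B? : Decidable B) (C? : Decidable C) →
                 C ≐ A ∪ B → A ⊥ B → size C? ≡ size A? + size B?
size-partition A? B? C? C≐A∪B A⊥B = begin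
  size C?                              ≡⟨ size-≐ C? (A? ∪? B?) C≐A∪B ⟩
  size (A? ∪? B?)                      ≡⟨ +-identityʳ _ ⟨
  size (A? ∪? B?) + 0                  ≡⟨ cong (size (A? ∪? B?) +_) (size-∅ (A? ∩? B?) (λ _ → A⊥B)) ⟨
  size (A? ∪? B?) + size (A? ∩? B?)    ≡⟨ size-∪-∩ A? B? ⟩
  size A? + size B?                    ∎
  where open ≡-Reasoning

module _ {A : Pred (Fin (suc n)) ℓ} (A? : Decidable A) where

  size-suc-∉ : ¬ A zero → size A? ≡ size (A? ∘ suc)
  size-suc-∉ ∉ with A? zero
  ... | yes ∈ = contradiction ∈ ∉
  ... | no _  = refl

  size-suc-∈ : A zero → size A? ≡ suc (size (A? ∘ suc))
  size-suc-∈ ∈ with A? zero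
  ... | yes _ = refl
  ... | no ∉  = contradiction ∈ ∉

∑-zero : (f : Fin n → ℕ) → (∀ x → f x ≡ 0) → ∑[ x < n ] f x ≡ 0
∑-zero {n} f f≗0 = trans (sum-cong-≗ f≗0) (sum-replicate-zero n)

∑-single : (f : Fin n → ℕ) (u : Fin n) → (∀ x → x ≢ u → f x ≡ 0) → ∑[ x < n ] f x ≡ f u
∑-single f zero    f≗0 =
  trans (cong (f zero +_) (∑-zero (f ∘ suc) (λ x → f≗0 (suc x) λ ()))) (+-identityʳ _)
∑-single f (suc u) f≗0 =
  trans (cong (_+ ∑[ x < _ ] f (suc x)) (f≗0 zero λ ()))
        (∑-single (f ∘ suc) u (λ x x≢u → f≗0 (suc x) (x≢u ∘ Fin.suc-injective)))

size≡∑ : {A : Pred (Fin n) ℓ} (A? : Decidable A) → size A? ≡ ∑[ x < n ] (if does (A? x) then 1 else 0)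
size≡∑ {zero}  A? = refl
size≡∑ {suc n} A? = cong ((if does (A? zero) then 1 else 0) +_) (size≡∑ (A? ∘ suc))

∑-size-transpose : {A : Fin m → Pred (Fin n) ℓ} (A? : ∀ x y → Dec (A x y)) →
                   ∑[ x < m ] size (A? x) ≡ ∑[ y < n ] size (λ x → A? x y)
∑-size-transpose {m} {n} A? = begin
  ∑[ x < m ] size (A? x)                                    ≡⟨ sum-cong-≗ (λ x → size≡∑ (A? x)) ⟩
  ∑[ x < m ] ∑[ y < n ] (if does (A? x y) then 1 else 0)    ≡⟨ ∑-comm (λ x y → if does (A? x y) then 1 else 0) ⟩
  ∑[ y < n ] ∑[ x < m ] (if does (A? x y) then 1 else 0)    ≡⟨ sum-cong-≗ (λ y → size≡∑ (λ x → A? x y)) ⟨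
  ∑[ y < n ] size (λ x → A? x y)                            ∎
  where open ≡-Reasoning

∑-size-row : {A : Pred (Fin n) ℓ} (A? : Decidable A) (u : Fin m) →
             ∑[ x < m ] size (λ y → (x ≟ u) ×-dec A? y) ≡ size A?
∑-size-row {A = A} A? u =
  trans (∑-single (λ x → size (row? x)) u other-rows-empty) (size-≐ (row? u) A? (proj₂ , (refl ,_)))
  where
  row? : ∀ x → Decidable (λ y → x ≡ u × A y)
  row? x y = (x ≟ u) ×-dec A? y

  other-rows-empty : ∀ x → x ≢ u → size (row? x) ≡ 0
  other-rows-empty x x≢u = size-∅ (row? x) (λ y (x≡u , _) → x≢u x≡u)

∑-size-partition : {A : Fin m → Pred (Fin n) ℓ} {B : Fin m → Pred (Fin n) ℓ′} {C : Fin m → Pred (Fin n) ℓ″}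
                   (A? : ∀ x → Decidable (A x)) (B? : ∀ x → Decidable (B x)) (C? : ∀ x → Decidable (C x)) →
                   (∀ x → C x ≐ A x ∪ B x) → (∀ x → A x ⊥ B x) →
                   ∑[ x < m ] size (C? x) ≡ ∑[ x < m ] size (A? x) + ∑[ x < m ] size (B? x)
∑-size-partition A? B? C? C≐A∪B A⊥B =
  trans (sum-cong-≗ (λ x → size-partition (A? x) (B? x) (C? x) (C≐A∪B x) (A⊥B x)))
        (∑-distrib-+ (λ x → size (A? x)) (λ x → size (B? x)))

-- Ranks with respect to an injective key into a strict total order

module Rank {a ℓ₁ ℓ₂} (O : StrictTotalOrder a ℓ₁ ℓ₂) where
  open StrictTotalOrder O using (_≈_; compare; module Eq)
    renaming (Carrier to K; _<_ to _⊏_; _<?_ to _⊏?_; trans to ⊏-trans; irrefl to ⊏-irrefl)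

  module _ {S : Pred (Fin n) ℓ} (S? : Decidable S) (key : Fin n → K) where

    Above : K → Pred (Fin n) (ℓ ⊔ ℓ₂)
    Above k y = S y × k ⊏ key y

    above? : ∀ k → Decidable (Above k)
    above? k y = S? y ×-dec (k ⊏? key y)

    rank : K → ℕ
    rank k = size (above? k)

    rank≤size : ∀ k → rank k ≤ size S?
    rank≤size k = size-⊆ (above? k) S? proj₁

    rank<size : ∀ {w} → S w → rank (key w) < size S?
    rank<size {w} Sw = size-⊂ (above? (key w)) S? proj₁ w Sw (λ (_ , w⊏w) → ⊏-irrefl Eq.refl w⊏w)

    rank-antimono : ∀ {k k′} → k ⊏ k′ → rank k′ ≤ rank k
    rank-antimono k⊏k′ = size-⊆ (above? _) (above? _) (λ (Sy , k′⊏y) → Sy , ⊏-trans k⊏k′ k′⊏y)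

    rank-strictly-antimono : ∀ {k w} → k ⊏ key w → S w → rank (key w) < rank k
    rank-strictly-antimono {k} {w} k⊏w Sw =
      size-⊂ (above? (key w)) (above? k) (λ (Sy , w⊏y) → Sy , ⊏-trans k⊏w w⊏y) w
        (Sw , k⊏w) (λ (_ , w⊏w) → ⊏-irrefl Eq.refl w⊏w)

    rank-injective : Injective _≡_ _≈_ key →
                     ∀ {w w′} → S w → S w′ → rank (key w) ≡ rank (key w′) → w ≡ w′
    rank-injective key-inj {w} {w′} Sw Sw′ rw≡rw′ with compare (key w) (key w′)
    ... | tri< w⊏w′ _ _ = contradiction (sym rw≡rw′) (<⇒≢ (rank-strictly-antimono w⊏w′ Sw′))
    ... | tri≈ _ w≈w′ _ = key-inj w≈w′
    ... | tri> _ _ w′⊏w = contradiction rw≡rw′ (<⇒≢ (rank-strictly-antimono w′⊏w Sw))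

    shifted-rank-fibre≤1 : Injective _≡_ _≈_ key →
                           ∀ b c → size (λ w → S? w ×-dec (b + rank (key w) ℕ.≟ c)) ≤ 1
    shifted-rank-fibre≤1 key-inj b c = size-≤1 (λ w → S? w ×-dec (b + rank (key w) ℕ.≟ c))
      λ (Sw , bw≡c) (Sw′ , bw′≡c) →
        rank-injective key-inj Sw Sw′ (+-cancelˡ-≡ b _ _ (trans bw≡c (sym bw′≡c)))

  rank-surjective : {S : Pred (Fin n) ℓ} (S? : Decidable S) (key : Fin n → K) →
                    Injective _≡_ _≈_ key → ∀ {j} → j < size S? → ∃ λ w → S w × rank S? key (key w) ≡ j
  rank-surjective {n = suc n} {S = S} S? key key-inj = from-head (S? zero) _
    where
    S′? : Decidable (S ∘ suc)
    S′? = S? ∘ suc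

    key′ : Fin n → K
    key′ = key ∘ suc

    IH : ∀ {j} → j < size S′? → ∃ λ w → S (suc w) × rank S′? key′ (key′ w) ≡ j
    IH = rank-surjective S′? key′ (Fin.suc-injective ∘ key-inj)

    r₀ : ℕ
    r₀ = rank S′? key′ (key zero)

    from-head : Dec (S zero) → ∀ j → j < size S? → ∃ λ w → S w × rank S? key (key w) ≡ j
    from-head (no ¬S₀) j j<|S| =
      let w , Sw , rw≡j = IH (subst (j <_) (size-suc-∉ S? ¬S₀) j<|S|)
      in suc w , Sw , trans (size-suc-∉ (above? S? key _) (¬S₀ ∘ proj₁)) rw≡j
    from-head (yes S₀) j j<|S| with <-cmp j r₀
    ... | tri≈ _ j≡r₀ _ =
      zero , S₀ , trans (size-suc-∉ (above? S? key _) (λ (_ , 0⊏0) → ⊏-irrefl Eq.refl 0⊏0)) (sym j≡r₀)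
    ... | tri< j<r₀ _ _ =
      let w , Sw , rw≡j = IH (<-≤-trans j<r₀ (rank≤size S′? key′ (key zero)))
          w⋢0 : ¬ Above S? key (key (suc w)) zero
          w⋢0 (_ , w⊏0) = <⇒≱ j<r₀ (subst (r₀ ≤_) rw≡j (rank-antimono S′? key′ w⊏0))
      in suc w , Sw , trans (size-suc-∉ (above? S? key _) w⋢0) rw≡j
    from-head (yes S₀) (suc j) j<|S| | tri> _ _ r₀<j =
      let w , Sw , rw≡j = IH (s<s⁻¹ (subst (suc j <_) (size-suc-∈ S? S₀) j<|S|))
      in suc w , Sw , trans (size-suc-∈ (above? S? key _) (S₀ , w⊏0 w Sw rw≡j)) (cong suc rw≡j)
      where
      w⊏0 : ∀ w → S (suc w) → rank S′? key′ (key′ w) ≡ j → key (suc w) ⊏ key zero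
      w⊏0 w Sw rw≡j with compare (key (suc w)) (key zero)
      ... | tri< w⊏0 _ _ = w⊏0
      ... | tri≈ _ w≈0 _ = contradiction (key-inj w≈0) λ ()
      ... | tri> _ _ 0⊏w =
        contradiction (subst (_< r₀) rw≡j (rank-strictly-antimono S′? key′ 0⊏w Sw)) (≤⇒≯ (s≤s⁻¹ r₀<j))

  shifted-rank-surjective : {S : Pred (Fin n) ℓ} (S? : Decidable S) (key : Fin n → K) →
                            Injective _≡_ _≈_ key → ∀ {w b c} → S w → b ≤ c → c ≤ b + rank S? key (key w) →
                            ∃ λ w′ → S w′ × b + rank S? key (key w′) ≡ c
  shifted-rank-surjective S? key key-inj {w} {b} {c} Sw b≤c c≤b+r =
    let w′ , Sw′ , rw′≡c∸b = rank-surjective S? key key-inj (≤-<-trans c∸b≤r (rank<size S? key Sw))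
    in w′ , Sw′ , trans (cong (b +_) rw′≡c∸b) (m+[n∸m]≡n b≤c)
    where
    c∸b≤r : c ∸ b ≤ rank S? key (key w)
    c∸b≤r = ≤-trans (∸-monoˡ-≤ b c≤b+r) (≤-reflexive (m+n∸m≡n b _))

-- The colouring of an outerplane graph

module Outerplane {n} (G : Graph n) (embedding : Outerplanar G) where

  p : Fin n → ℕ
  p = toℕ ∘ proj₁ embedding

  p-injective : Injective _≡_ _≡_ p
  p-injective = proj₁ (proj₂ embedding) ∘ Fin.toℕ-injective

  Edge : Fin n → Fin n → Set
  Edge u v = T (adj G u v)

  edge? : ∀ u v → Dec (Edge u v)
  edge? u v = T? (adj G u v)

  edge-sym : ∀ {u v} → Edge u v → Edge v u
  edge-sym {u} {v} = subst T (symm G u v)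

  edge⇒adj : ∀ {u v} → Edge u v → adj G u v ≡ true
  edge⇒adj = Equivalence.to T-≡

  adj⇒edge : ∀ {u v} → adj G u v ≡ true → Edge u v
  adj⇒edge = Equivalence.from T-≡

  edge-irrefl : ∀ {v} → ¬ Edge v v
  edge-irrefl {v} = subst T (irrefl G v)

  noncrossing : ∀ {u v x y} → Edge u v → Edge x y → ¬ (p u < p x × p x < p v × p v < p y)
  noncrossing {u} {v} {x} {y} uv xy = proj₂ (proj₂ embedding) u v x y (edge⇒adj uv) (edge⇒adj xy)

  Spans : Fin n → Fin n → Fin n → Set
  Spans v x y = Edge x y × p x < p v × p v < p y

  spans? : ∀ v x y → Dec (Spans v x y)
  spans? v x y = edge? x y ×-dec (p x <? p v ×-dec p v <? p y)

  depth : Fin n → ℕ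
  depth v = ∑[ x < n ] size (spans? v x)

  Forward Backward : Fin n → Fin n → Set
  Forward v w = Edge v w × p v < p w
  Backward v w = Edge v w × p w < p v

  forward? : ∀ v w → Dec (Forward v w)
  forward? v w = edge? v w ×-dec p v <? p w

  backward? : ∀ v w → Dec (Backward v w)
  backward? v w = edge? v w ×-dec p w <? p v

  module ↑ = Rank <-strictTotalOrder
  -- In the reversed order, `Above` means "earlier on the circle".
  module ↓ = Rank (Flip.strictTotalOrder <-strictTotalOrder)

  beyond : Fin n → Fin n → ℕ
  beyond v w = ↑.rank (forward? v) p (p w)

  before : Fin n → Fin n → ℕ
  before v w = ↓.rank (backward? v) p (p w)

  module Nesting {u v} (uv : Edge u v) (u<v : p u < p v) where

    Nests : Fin n → Fin n → Set
    Nests x y = Edge x y × p x ≤ p u × p v ≤ p y × (p x < p u ⊎ p v < p y)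

    nests? : ∀ x y → Dec (Nests x y)
    nests? x y = edge? x y ×-dec (p x ≤? p u ×-dec (p v ≤? p y ×-dec (p x <? p u ⊎-dec p v <? p y)))

    Row : Fin n → Fin n → Set
    Row x y = x ≡ u × ↑.Above (forward? u) p (p v) y

    row? : ∀ x y → Dec (Row x y)
    row? x y = (x ≟ u) ×-dec ↑.above? (forward? u) p (p v) y

    Column : Fin n → Fin n → Set
    Column y x = y ≡ v × ↓.Above (backward? v) p (p u) x

    column? : ∀ y x → Dec (Column y x)
    column? y x = (y ≟ v) ×-dec ↓.above? (backward? v) p (p u) x

    nests-row : ∀ x → Nests x ≐ Spans u x ∪ Row x
    nests-row x = split , join
      where
      split : Nests x ⊆ Spans u x ∪ Row x
      split (xy , x≤u , v≤y , x<u⊎v<y) with m≤n⇒m<n∨m≡n x≤u | x<u⊎v<y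
      ... | inj₁ x<u | _        = inj₁ (xy , x<u , <-≤-trans u<v v≤y)
      ... | inj₂ x≡u | inj₁ x<u = contradiction x≡u (<⇒≢ x<u)
      ... | inj₂ x≡u | inj₂ v<y with refl ← p-injective x≡u = inj₂ (refl , (xy , <-trans u<v v<y) , v<y)
      join : Spans u x ∪ Row x ⊆ Nests x
      join (inj₁ (xy , x<u , u<y)) = xy , <⇒≤ x<u , ≮⇒≥ (λ y<v → noncrossing xy uv (x<u , u<y , y<v)) , inj₁ x<u
      join (inj₂ (refl , (uy , _) , v<y)) = uy , ≤-refl , <⇒≤ v<y , inj₂ v<y

    spans-row-disjoint : ∀ x → Spans u x ⊥ Row x
    spans-row-disjoint x ((_ , x<u , _) , refl , _) = <-irrefl refl x<u

    nests-column : ∀ y → (λ x → Nests x y) ≐ (λ x → Spans v x y) ∪ Column y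
    nests-column y = split , join
      where
      split : (λ x → Nests x y) ⊆ (λ x → Spans v x y) ∪ Column y
      split (xy , x≤u , v≤y , x<u⊎v<y) with m≤n⇒m<n∨m≡n v≤y | x<u⊎v<y
      ... | inj₁ v<y | _        = inj₁ (xy , ≤-<-trans x≤u u<v , v<y)
      ... | inj₂ v≡y | inj₂ v<y = contradiction v≡y (<⇒≢ v<y)
      ... | inj₂ v≡y | inj₁ x<u with refl ← p-injective v≡y = inj₂ (refl , (edge-sym xy , <-trans x<u u<v) , x<u)
      join : (λ x → Spans v x y) ∪ Column y ⊆ (λ x → Nests x y)
      join (inj₁ (xy , x<v , v<y)) = xy , ≮⇒≥ (λ u<x → noncrossing uv xy (u<x , x<v , v<y)) , <⇒≤ v<y , inj₂ v<y
      join (inj₂ (refl , (vx , _) , x<u)) = edge-sym vx , <⇒≤ x<u , ≤-refl , inj₁ x<u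

    spans-column-disjoint : ∀ y → (λ x → Spans v x y) ⊥ Column y
    spans-column-disjoint y ((_ , _ , v<y) , refl , _) = <-irrefl refl v<y

    depth+beyond≡depth+before : depth u + beyond u v ≡ depth v + before v u
    depth+beyond≡depth+before = begin
      depth u + beyond u v
        ≡⟨ cong (depth u +_) (∑-size-row (↑.above? (forward? u) p (p v)) u) ⟨
      depth u + ∑[ x < n ] size (row? x)
        ≡⟨ ∑-size-partition (spans? u) row? nests? nests-row spans-row-disjoint ⟨
      ∑[ x < n ] size (nests? x)
        ≡⟨ ∑-size-transpose nests? ⟩
      ∑[ y < n ] size (λ x → nests? x y)
        ≡⟨ ∑-size-partition (λ y x → spans? v x y) column? (λ y x → nests? x y)
                            nests-column spans-column-disjoint ⟩
      ∑[ y < n ] size (λ x → spans? v x y) + ∑[ y < n ] size (column? y)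
        ≡⟨ cong₂ _+_ (sym (∑-size-transpose (spans? v)))
                     (∑-size-row (↓.above? (backward? v) p (p u)) v) ⟩
      depth v + before v u
        ∎
      where open ≡-Reasoning

  colour : Fin n → Fin n → ℕ
  colour v w = if p v <ᵇ p w then depth v + beyond v w else depth w + beyond w v

  colour-forward : ∀ {v w} → p v < p w → colour v w ≡ depth v + beyond v w
  colour-forward {v} {w} v<w with p v <ᵇ p w | <ᵇ-reflects-< (p v) (p w)
  ... | true  | _        = refl
  ... | false | ofⁿ v≮w = contradiction v<w v≮w

  colour-reversed : ∀ {v w} → p w < p v → colour v w ≡ depth w + beyond w v
  colour-reversed {v} {w} w<v with p v <ᵇ p w | <ᵇ-reflects-< (p v) (p w)
  ... | true  | ofʸ v<w = contradiction v<w (<-asym w<v)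
  ... | false | _        = refl

  colour-backward : ∀ {v w} → Backward v w → colour v w ≡ depth v + before v w
  colour-backward (vw , w<v) =
    trans (colour-reversed w<v) (Nesting.depth+beyond≡depth+before (edge-sym vw) w<v)

  forward-or-backward : ∀ {v w} → Edge v w → Forward v w ⊎ Backward v w
  forward-or-backward {v} {w} vw with <-cmp (p v) (p w)
  ... | tri< v<w _ _ = inj₁ (vw , v<w)
  ... | tri> _ _ w<v = inj₂ (vw , w<v)
  ... | tri≈ _ v≡w _ with refl ← p-injective v≡w = contradiction vw edge-irrefl

  colour-symmetric : EdgeColoring G colour
  colour-symmetric u v uv with forward-or-backward (adj⇒edge uv)
  ... | inj₁ (_ , u<v) = trans (colour-forward u<v) (sym (colour-reversed u<v))
  ... | inj₂ (_ , v<u) = trans (colour-reversed v<u) (sym (colour-forward v<u))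

  colour-improper : Improper G 2 colour
  colour-improper v c = begin
    size colour-class?
      ≤⟨ size-⊆-∪ forward-class? backward-class? colour-class? by-direction ⟩
    size forward-class? + size backward-class?
      ≤⟨ +-mono-≤ (↑.shifted-rank-fibre≤1 (forward? v) p p-injective (depth v) c)
                  (↓.shifted-rank-fibre≤1 (backward? v) p p-injective (depth v) c) ⟩
    2 ∎
    where
    open ≤-Reasoning
    colour-class? : Decidable (λ w → Edge v w × colour v w ≡ c)
    colour-class? w = edge? v w ×-dec (colour v w ℕ.≟ c)
    forward-class? : Decidable (λ w → Forward v w × depth v + beyond v w ≡ c)
    forward-class? w = forward? v w ×-dec (depth v + beyond v w ℕ.≟ c)
    backward-class? : Decidable (λ w → Backward v w × depth v + before v w ≡ c)
    backward-class? w = backward? v w ×-dec (depth v + before v w ℕ.≟ c)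
    by-direction : (λ w → Edge v w × colour v w ≡ c) ⊆
                   (λ w → Forward v w × depth v + beyond v w ≡ c) ∪ (λ w → Backward v w × depth v + before v w ≡ c)
    by-direction (vw , vw≡c) with forward-or-backward vw
    ... | inj₁ fw = inj₁ (fw , trans (sym (colour-forward (proj₂ fw))) vw≡c)
    ... | inj₂ bw = inj₂ (bw , trans (sym (colour-backward bw)) vw≡c)

  depth≤colour : ∀ {v w} → Edge v w → depth v ≤ colour v w
  depth≤colour vw with forward-or-backward vw
  ... | inj₁ fw = ≤-trans (m≤m+n _ _) (≤-reflexive (sym (colour-forward (proj₂ fw))))
  ... | inj₂ bw = ≤-trans (m≤m+n _ _) (≤-reflexive (sym (colour-backward bw)))

  colour-interval : Interval G colour
  colour-interval v w₁ w₂ c vw₁ vw₂ w₁≤c c≤w₂ = fill (forward-or-backward (adj⇒edge vw₂))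
    where
    depth≤c : depth v ≤ c
    depth≤c = ≤-trans (depth≤colour (adj⇒edge vw₁)) w₁≤c

    fill : Forward v w₂ ⊎ Backward v w₂ → ∃ λ w → adj G v w ≡ true × colour v w ≡ c
    fill (inj₁ fw₂) =
      let w , fw , e = ↑.shifted-rank-surjective (forward? v) p p-injective fw₂ depth≤c
                         (subst (c ≤_) (colour-forward (proj₂ fw₂)) c≤w₂)
      in w , edge⇒adj (proj₁ fw) , trans (colour-forward (proj₂ fw)) e
    fill (inj₂ bw₂) =
      let w , bw , e = ↓.shifted-rank-surjective (backward? v) p p-injective bw₂ depth≤c
                         (subst (c ≤_) (colour-backward bw₂) c≤w₂)
      in w , edge⇒adj (proj₁ bw) , trans (colour-backward bw) e

proposition27 : ∀ (n : ℕ) (G : Graph n) → Outerplanar G → MaxDegree≤ G 8 → μint≤ G 2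
proposition27 n G embedding _ = 2 , ≤-refl , colour , colour-symmetric , colour-improper , colour-interval
  where open Outerplane G embedding
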